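{- Let $\mathbf{k}$ be a field, take $q=1$ (so that $\mathcal{H}_n=\mathbf{k}[S_n]$ with $T_w=w$), and let $n\ge k\ge0$. For $w\in S_n$ let $\mathrm{noninv}_k(w)$ be the number of $k$-element subsets of $[n]$ on which $w$ is strictly increasing. Then $$\mathcal{R}_{n,n-k}(1)=\sum_{w\in S_n}\mathrm{noninv}_k(w)\,w\in\mathbf{k}[S_n].$$
   Context: $\mathcal{H}_n$ is the Hecke algebra over $\mathbf{k}$ with parameter $q$: generated by $T_1,\dots,T_{n-1}$ with $T_i^2=(q-1)T_i+q$, $T_iT_j=T_jT_i$ for $|i-j|>1$, $T_iT_{i+1}T_i=T_{i+1}T_iT_{i+1}$, basis $(T_w)_{w\in S_n}$ with $T_w=T_{i_1}\cdots T_{i_r}$ for a reduced expression $w=s_{i_1}\cdots s_{i_r}$, $s_i=(i,i+1)$. $[k]_q=1+\cdots+q^{k-1}$, $[k]!_q=[1]_q\cdots[k]_q$. For an integer $m$, $\mathcal{B}_m=\sum_{i=1}^mT_{m-1}\cdots T_i$, $\mathcal{B}^*_m=\sum_{i=1}^mT_i\cdots T_{m-1}$ ($0$ if $m\le0$); $\mathcal{B}_{n,k}=\mathcal{B}_{n-k+1}\cdots\mathcal{B}_n$, $\mathcal{B}^*_{n,k}=\mathcal{B}^*_n\cdots\mathcal{B}^*_{n-k+1}$; $\mathcal{R}_{n,k}=\frac1{[k]!_q}\mathcal{B}^*_{n,k}\mathcal{B}_{n,k}$, which for indeterminate $q$ has $\mathbb{Z}[q]$ coefficients; $\mathcal{R}_{n,k}(1)$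 denotes its specialization at $q=1$, an element of $\mathbf{k}[S_n]$. Permutations multiply by $(\alpha\beta)(i)=\alpha(\beta(i))$. -}

module Defs where

open import Data.Nat using (_≟_; ℕ; zero; suc; _+_; _*_; _∸_; _!; _<?_; _/_)
open import Data.Nat.Properties using (<-trans; n<1+n; _!≢0)
open import Data.Fin using (Fin; fromℕ<; _<_)
open import Data.Fin.Properties using (all?) renaming (_<?_ to _<ᶠ?_; _≟_ to _≟ᶠ_)
open import Data.Fin.Permutation using (Permutation′; id; transpose; _∘ₚ_; _⟨$⟩ʳ_)
open import Data.Fin.Subset using (Subset; _∈_; ∣_∣; inside; outside)
open import Data.Fin.Subset.Properties using (_∈?_)
open import Data.List using (List; []; _∷_; map; _++_; concatMap; foldr; upTo; length; filter)
open import Data.Vec using ([]; _∷_)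
open import Relation.Nullary using (Dec; yes; no)
open import Relation.Nullary.Decidable using (_→-dec_; _×-dec_)
open import Data.Product using (_×_)
open import Relation.Binary.PropositionalEquality using (_≡_)

-- The symmetric group S_n: permutations of Fin n ≅ [n] (0-based: Fin value j stands for j+1).
Perm : ℕ → Set
Perm n = Permutation′ n

-- Product in the paper's convention (αβ)(i) = α(β(i)).
-- (stdlib's  π ∘ₚ ρ  applies π first, then ρ.)
_·_ : ∀ {n} → Perm n → Perm n → Perm n
α · β = β ∘ₚ α

-- Simple transposition s_a = (a, a+1) of [n], for 1 ≤ a ≤ n-1
-- (in Fin n: swaps a-1 and a).  Only used for a in that range;
-- out-of-range indices default to the identity.
s : ∀ {n} → ℕ → Perm n
s {n} zero = id
s {n} (suc b) with suc b <? n
... | yes p = transpose (fromℕ< (<-trans (n<1+n b) p)) (fromℕ< p)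
... | no _  = id

-- product s_{a₁} s_{a₂} ⋯ s_{a_r} (= T_{a₁}⋯T_{a_r} at q = 1)
word : ∀ {n} → List ℕ → Perm n
word []       = id
word (a ∷ as) = s a · word as

-- Elements of ℕ[S_n] (all elements needed have nonnegative integer
-- coefficients at q = 1) represented as formal sums: a list of permutations,
-- the coefficient of w being its multiplicity.
Alg : ℕ → Set
Alg n = List (Perm n)

_⊕_ : ∀ {n} → Alg n → Alg n → Alg n
_⊕_ = _++_

_⊗_ : ∀ {n} → Alg n → Alg n → Alg n
xs ⊗ ys = concatMap (λ x → map (x ·_) ys) xs

one : ∀ {n} → Alg n
one = id ∷ []

prodAlg : ∀ {n} → List (Alg n) → Alg n
prodAlg = foldr _⊗_ one

-- [a, a+1, …, b]   (empty if b < a)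
range : ℕ → ℕ → List ℕ
range a b = map (a +_) (upTo (suc b ∸ a))

-- [b, b-1, …, a]   (empty if b < a)
rangeDown : ℕ → ℕ → List ℕ
rangeDown a b = foldr (λ x acc → acc ++ (x ∷ [])) [] (range a b)

-- 𝓑_m = Σ_{i=1}^m T_{m-1} ⋯ T_i   (0 if m ≤ 0), at q = 1
𝓑 : ∀ {n} → ℕ → Alg n
𝓑 m = map (λ i → word (rangeDown i (m ∸ 1))) (range 1 m)

-- 𝓑*_m = Σ_{i=1}^m T_i ⋯ T_{m-1}, at q = 1
𝓑* : ∀ {n} → ℕ → Alg n
𝓑* m = map (λ i → word (range i (m ∸ 1))) (range 1 m)

-- 𝓑_{n,k} = 𝓑_{n-k+1} ⋯ 𝓑_n
𝓑nk : ∀ n → ℕ → Alg n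
𝓑nk n k = prodAlg (map 𝓑 (range (suc (n ∸ k)) n))

-- 𝓑*_{n,k} = 𝓑*_n ⋯ 𝓑*_{n-k+1}
𝓑*nk : ∀ n → ℕ → Alg n
𝓑*nk n k = prodAlg (map 𝓑* (rangeDown (suc (n ∸ k)) n))

_≟ₚ_ : ∀ {n} (π ρ : Perm n) → Dec (∀ i → π ⟨$⟩ʳ i ≡ ρ ⟨$⟩ʳ i)
π ≟ₚ ρ = all? (λ i → (π ⟨$⟩ʳ i) ≟ᶠ (ρ ⟨$⟩ʳ i))

coeff : ∀ {n} → Alg n → Perm n → ℕ
coeff xs w = length (filter (λ x → x ≟ₚ w) xs)

-- coefficient of w in 𝓡_{n,k}(1) = (1/k!) 𝓑*_{n,k} 𝓑_{n,k} (at q = 1, [k]!_1 = k!)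
𝓡coeff : ∀ n → ℕ → Perm n → ℕ
𝓡coeff n k w = _/_ (coeff (𝓑*nk n k ⊗ 𝓑nk n k) w) (k !) {{k !≢0}}

allSubsets : ∀ n → List (Subset n)
allSubsets zero    = [] ∷ []
allSubsets (suc n) = map (inside ∷_) (allSubsets n) ++ map (outside ∷_) (allSubsets n)

IncreasingOn : ∀ {n} → Perm n → Subset n → Set
IncreasingOn w S = ∀ i j → i ∈ S → j ∈ S → i < j → (w ⟨$⟩ʳ i) < (w ⟨$⟩ʳ j)

increasingOn? : ∀ {n} (w : Perm n) (S : Subset n) → Dec (IncreasingOn w S)
increasingOn? w S = all? (λ i → all? (λ j →
  (i ∈? S) →-dec ((j ∈? S) →-dec ((i <ᶠ? j) →-dec ((w ⟨$⟩ʳ i) <ᶠ? (w ⟨$⟩ʳ j))))))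

noninv : ∀ {n} → ℕ → Perm n → ℕ
noninv {n} k w = length (filter (λ S → (∣ S ∣ ≟ k) ×-dec increasingOn? w S) (allSubsets n))

-- At q = 1 every T_w is the permutation w, so 𝓑_{n,j} and 𝓑*_{n,j} are sums of permutations.
-- 𝓑*_{n,j} is the sum, each with multiplicity one, of the permutations z increasing on the first
-- n − j positions: writing 𝓑*_{n,j+1} = 𝓑*_{n,j} 𝓑*_{M+1} with M = n − j − 1, the terms c of
-- 𝓑*_{M+1} make z c⁻¹ carry the value at position M to each position a ≤ M in turn, and exactly
-- one of these is increasing on the first M + 1 positions if z is increasing on the first M,
-- none otherwise. Every term y of 𝓑_{n,j} has y⁻¹ increasing on the first n − j positions, so the
-- coefficient of w in 𝓑*_{n,j} 𝓑_{n,j} counts the terms y of 𝓑_{n,j} for which w is increasing on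
-- U = y⁻¹{0, …, n − j − 1}. Each factor 𝓑_{M+1} removes one point from U, and double counting
-- (an r-set is U − x for exactly n − r pairs with x ∈ U) shows that every (n − j)-set arises
-- from exactly j! terms; dividing by j! leaves noninv_{n−j}(w).

module Submission where

open import Defs
open import Data.Bool using (true; if_then_else_)
open import Data.Empty using (⊥-elim)
open import Data.Fin using (Fin; zero; suc; toℕ; fromℕ<) renaming (_≟_ to _≟ᶠ_)
open import Data.Fin.Properties using (toℕ-fromℕ<; toℕ-injective; toℕ<n; all?)
open import Data.Fin.Permutation using (id; flip; _⟨$⟩ʳ_; _⟨$⟩ˡ_; inverseˡ; inverseʳ) renaming (_≈_ to _≈ₚ_)
import Data.Fin.Permutation.Components as PC
open import Data.Fin.Subset using (Subset; inside; outside; ∣_∣; _∈_; _∉_; _-_; ⊤; ⁅_⁆)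
open import Data.Fin.Subset.Properties using (_∈?_; p─⊥≡p; p─q⊆p; x∈p∧x≢y⇒x∈p-y; ⊆-antisym; ∈⊤; drop-there)
open import Data.List using (List; []; _∷_; map; _++_; _∷ʳ_; concatMap; foldr; upTo; applyUpTo; length; filter)
open import Data.List.Properties using (map-++; map-cong; map-∘; map-upTo; map-applyUpTo)
open import Data.Nat using (ℕ; zero; suc; _+_; _*_; _∸_; _≤_; _<_; z≤n; s≤s; _<?_; _≤?_; _!; _/_)
open import Data.Nat.DivMod using (m*n/n≡m)
open import Data.Nat.ListAction using (sum)
open import Data.Nat.ListAction.Properties using (sum-++)
open import Data.Nat.Properties
open import Data.Nat.Solver using (module +-*-Solver)
open import Algebra.Properties.CommutativeSemigroup +-commutativeSemigroup using (interchange)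
open import Algebra.Properties.CommutativeMonoid.Sum +-0-commutativeMonoid
  using (sum-cong-≗; sum-permute; sum-replicate-zero) renaming (sum to ∑ᶠ)
open import Data.Product using (_×_; _,_; proj₁)
open import Data.Product.Function.NonDependent.Propositional using (_×-⇔_)
open import Data.Sum using (_⊎_; inj₁; inj₂)
open import Data.Vec using ([]; _∷_; tabulate)
open import Data.Vec.Properties using (lookup∘tabulate; []=⇒lookup; lookup⇒[]=)
open import Function.Base using (_∘_)
open import Function.Bundles using (Injection; _⇔_; mk⇔; Equivalence)
open import Function.Properties.Inverse using (↔⇒↣)
import Function.Properties.Equivalence as ⇔
open import Relation.Binary.Core using (_Preserves_⟶_)
open import Relation.Binary.Definitions using (tri<; tri≈; tri>)
open import Relation.Binary.PropositionalEquality
open import Relation.Nullary using (Dec; yes; no; does; ¬_)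
open import Relation.Nullary.Decidable using (does-⇔; dec-true; dec-false; _×-dec_; _→-dec_)

private variable
  A B : Set

∑ : List A → (A → ℕ) → ℕ
∑ xs f = sum (map f xs)

∑-++ : (xs ys : List A) (f : A → ℕ) → ∑ (xs ++ ys) f ≡ ∑ xs f + ∑ ys f
∑-++ xs ys f = trans (cong sum (map-++ f xs ys)) (sum-++ (map f xs) (map f ys))

∑-cong : (xs : List A) {f g : A → ℕ} → (∀ x → f x ≡ g x) → ∑ xs f ≡ ∑ xs g
∑-cong xs f≗g = cong sum (map-cong f≗g xs)

∑-zero : (xs : List A) → ∑ xs (λ _ → 0) ≡ 0
∑-zero []       = refl
∑-zero (x ∷ xs) = ∑-zero xs

∑-+ : (xs : List A) (f g : A → ℕ) → ∑ xs (λ x → f x + g x) ≡ ∑ xs f + ∑ xs g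
∑-+ []       f g = refl
∑-+ (x ∷ xs) f g =
  trans (cong (f x + g x +_) (∑-+ xs f g)) (interchange (f x) (g x) (∑ xs f) (∑ xs g))

∑-map : (g : B → A) (xs : List B) (f : A → ℕ) → ∑ (map g xs) f ≡ ∑ xs (f ∘ g)
∑-map g xs f = cong sum (sym (map-∘ xs))

∑-concatMap : (g : B → List A) (xs : List B) (f : A → ℕ) →
              ∑ (concatMap g xs) f ≡ ∑ xs (λ x → ∑ (g x) f)
∑-concatMap g []       f = refl
∑-concatMap g (x ∷ xs) f =
  trans (∑-++ (g x) (concatMap g xs) f) (cong (∑ (g x) f +_) (∑-concatMap g xs f))

∑-swap : (xs : List A) (ys : List B) (f : A → B → ℕ) →
         ∑ xs (λ x → ∑ ys (f x)) ≡ ∑ ys (λ y → ∑ xs (λ x → f x y))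
∑-swap []       ys f = sym (∑-zero ys)
∑-swap (x ∷ xs) ys f =
  trans (cong (∑ ys (f x) +_) (∑-swap xs ys f)) (sym (∑-+ ys (f x) (λ y → ∑ xs (λ x → f x y))))

-- Defined through does rather than by matching on yes/no, so that it computes on decisions
-- built with map′: 𝟙 (suc x ∈? s ∷ p) reduces to 𝟙 (x ∈? p).
𝟙 : {P : Set} → Dec P → ℕ
𝟙 P? = if does P? then 1 else 0

𝟙-⇔ : {P Q : Set} → P ⇔ Q → (P? : Dec P) (Q? : Dec Q) → 𝟙 P? ≡ 𝟙 Q?
𝟙-⇔ P⇔Q P? Q? = cong (λ b → if b then 1 else 0) (does-⇔ P⇔Q P? Q?)

𝟙-×-dec : {P Q : Set} (P? : Dec P) (Q? : Dec Q) → 𝟙 (P? ×-dec Q?) ≡ 𝟙 P? * 𝟙 Q?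
𝟙-×-dec (yes _) (yes _) = refl
𝟙-×-dec (yes _) (no _)  = refl
𝟙-×-dec (no _)  _       = refl

𝟙-yes : {P : Set} (P? : Dec P) → P → 𝟙 P? ≡ 1
𝟙-yes P? p = cong (λ b → if b then 1 else 0) (dec-true P? p)

𝟙-no : {P : Set} (P? : Dec P) → ¬ P → 𝟙 P? ≡ 0
𝟙-no P? ¬p = cong (λ b → if b then 1 else 0) (dec-false P? ¬p)

𝟙-*-cong : {P : Set} (P? : Dec P) {m n : ℕ} → (P → m ≡ n) → 𝟙 P? * m ≡ 𝟙 P? * n
𝟙-*-cong (yes p) m≡n = cong (1 *_) (m≡n p)
𝟙-*-cong (no _)  _   = refl

length-filter≡∑𝟙 : {P : A → Set} (P? : ∀ x → Dec (P x)) (xs : List A) →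
                   length (filter P? xs) ≡ ∑ xs (𝟙 ∘ P?)
length-filter≡∑𝟙 P? []       = refl
length-filter≡∑𝟙 P? (x ∷ xs) with P? x
... | yes _ = cong suc (length-filter≡∑𝟙 P? xs)
... | no _  = length-filter≡∑𝟙 P? xs

∑-upTo-suc : ∀ c (g : ℕ → ℕ) → ∑ (upTo (suc c)) g ≡ g 0 + ∑ (upTo c) (g ∘ suc)
∑-upTo-suc c g = cong (g 0 +_) (begin
  sum (map g (applyUpTo suc c))      ≡⟨ cong sum (map-applyUpTo suc g c) ⟩
  sum (applyUpTo (g ∘ suc) c)        ≡⟨ cong sum (map-upTo (g ∘ suc) c) ⟨
  ∑ (upTo c) (g ∘ suc)                    ∎)
  where open ≡-Reasoning

∑-upTo-cong : ∀ c {g h : ℕ → ℕ} → (∀ x → x < c → g x ≡ h x) → ∑ (upTo c) g ≡ ∑ (upTo c) h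
∑-upTo-cong zero    g≗h = refl
∑-upTo-cong (suc c) {g} {h} g≗h = begin
  ∑ (upTo (suc c)) g         ≡⟨ ∑-upTo-suc c g ⟩
  g 0 + ∑ (upTo c) (g ∘ suc) ≡⟨ cong₂ _+_ (g≗h 0 (s≤s z≤n)) (∑-upTo-cong c (λ x x<c → g≗h (suc x) (s≤s x<c))) ⟩
  h 0 + ∑ (upTo c) (h ∘ suc) ≡⟨ ∑-upTo-suc c h ⟨
  ∑ (upTo (suc c)) h         ∎
  where open ≡-Reasoning

∑-upTo-zero : ∀ c (g : ℕ → ℕ) → (∀ x → x < c → g x ≡ 0) → ∑ (upTo c) g ≡ 0
∑-upTo-zero c g g≡0 = trans (∑-upTo-cong c g≡0) (∑-zero (upTo c))

∑-upTo≡∑ᶠ : ∀ n c (h : ℕ → ℕ) → c ≤ n → ∑ (upTo c) h ≡ ∑ᶠ {n} (λ x → 𝟙 (toℕ x <? c) * h (toℕ x))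
∑-upTo≡∑ᶠ n       zero    h _ = sym (sum-replicate-zero n)
∑-upTo≡∑ᶠ (suc n) (suc c) h (s≤s c≤n) =
  trans (∑-upTo-suc c h) (cong₂ _+_ (sym (+-identityʳ (h 0))) (∑-upTo≡∑ᶠ n c (h ∘ suc) c≤n))

m∸n≡1+m∸[1+n] : ∀ {m n} → n < m → m ∸ n ≡ suc (m ∸ suc n)
m∸n≡1+m∸[1+n] = +-∸-assoc 1

m∸[1+n]<m : ∀ {m n} → n < m → m ∸ suc n < m
m∸[1+n]<m {m} {n} n<m = subst (_≤ m) (m∸n≡1+m∸[1+n] n<m) (m∸n≤m m n)

module _ {M : ℕ} (P : ℕ → Set) (P-M : P M) (P-step : ∀ {a} → a < M → P (suc a) → P a) where

  downward-induction : ∀ {a} → a ≤ M → P a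
  downward-induction {a} a≤M = from (M ∸ a) a (m+[n∸m]≡n a≤M)
    where
    from : ∀ d a → a + d ≡ M → P a
    from zero    a a+0≡M = subst P (trans (sym a+0≡M) (+-identityʳ a)) P-M
    from (suc d) a a+d+1≡M = P-step a<M (from d (suc a) (trans (sym (+-suc a d)) a+d+1≡M))
      where a<M = subst (a <_) a+d+1≡M (m<m+n a (s≤s z≤n))

⟨$⟩ʳ-injective : ∀ {n} (π : Perm n) {i j} → π ⟨$⟩ʳ i ≡ π ⟨$⟩ʳ j → i ≡ j
⟨$⟩ʳ-injective π = Injection.injective (↔⇒↣ π)

≈ₚ-·-flip⇔ : ∀ {n} (x b z : Perm n) → (x · b) ≈ₚ z ⇔ x ≈ₚ (z · flip b)
≈ₚ-·-flip⇔ x b z = mk⇔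
  (λ xb≈z i → trans (cong (x ⟨$⟩ʳ_) (sym (inverseʳ b))) (xb≈z (b ⟨$⟩ˡ i)))
  (λ x≈zb⁻¹ i → trans (x≈zb⁻¹ (b ⟨$⟩ʳ i)) (cong (z ⟨$⟩ʳ_) (inverseˡ b)))

𝟙-≟ₚ-·-flip : ∀ {n} (x b z : Perm n) → 𝟙 ((x · b) ≟ₚ z) ≡ 𝟙 (x ≟ₚ (z · flip b))
𝟙-≟ₚ-·-flip x b z = 𝟙-⇔ (≈ₚ-·-flip⇔ x b z) ((x · b) ≟ₚ z) (x ≟ₚ (z · flip b))

𝟙-≟ₚ-resp : ∀ {n} (z : Perm n) → (λ x → 𝟙 (x ≟ₚ z)) Preserves _≈ₚ_ ⟶ _≡_
𝟙-≟ₚ-resp z {x} {y} x≈y = 𝟙-⇔ (mk⇔ (λ x≈z i → trans (sym (x≈y i)) (x≈z i)) (λ y≈z i → trans (x≈y i) (y≈z i)))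
                                 (x ≟ₚ z) (y ≟ₚ z)

∑-⊗ : ∀ {n} (xs ys : Alg n) (f : Perm n → ℕ) → ∑ (xs ⊗ ys) f ≡ ∑ xs (λ x → ∑ ys (λ y → f (x · y)))
∑-⊗ xs ys f = trans (∑-concatMap (λ x → map (x ·_) ys) xs f) (∑-cong xs (λ x → ∑-map (x ·_) ys f))

∑-prodAlg-∷ʳ : ∀ {n} (Xs : List (Alg n)) (Y : Alg n) (f : Perm n → ℕ) → f Preserves _≈ₚ_ ⟶ _≡_ →
               ∑ (prodAlg (Xs ∷ʳ Y)) f ≡ ∑ (prodAlg Xs) (λ x → ∑ Y (λ y → f (x · y)))
∑-prodAlg-∷ʳ [] Y f f-resp =
  trans (∑-⊗ Y one f) (trans (∑-cong Y (λ y → trans (+-identityʳ _) (f-resp (λ _ → refl)))) (sym (+-identityʳ _)))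
∑-prodAlg-∷ʳ (X ∷ Xs) Y f f-resp = begin
  ∑ (X ⊗ prodAlg (Xs ∷ʳ Y)) f
    ≡⟨ ∑-⊗ X (prodAlg (Xs ∷ʳ Y)) f ⟩
  ∑ X (λ x → ∑ (prodAlg (Xs ∷ʳ Y)) (λ p → f (x · p)))
    ≡⟨ ∑-cong X (λ x → ∑-prodAlg-∷ʳ Xs Y (λ p → f (x · p)) (λ p≈q → f-resp (cong (x ⟨$⟩ʳ_) ∘ p≈q))) ⟩
  ∑ X (λ x → ∑ (prodAlg Xs) (λ p → ∑ Y (λ y → f (x · (p · y)))))
    ≡⟨ ∑-cong X (λ x → ∑-cong (prodAlg Xs) (λ p → ∑-cong Y (λ y → f-resp (λ _ → refl)))) ⟩
  ∑ X (λ x → ∑ (prodAlg Xs) (λ p → ∑ Y (λ y → f ((x · p) · y))))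
    ≡⟨ ∑-⊗ X (prodAlg Xs) (λ p → ∑ Y (λ y → f (p · y))) ⟨
  ∑ (X ⊗ prodAlg Xs) (λ p → ∑ Y (λ y → f (p · y)))
    ∎
  where open ≡-Reasoning

coeff≡∑ : ∀ {n} (xs : Alg n) (w : Perm n) → coeff xs w ≡ ∑ xs (λ x → 𝟙 (x ≟ₚ w))
coeff≡∑ xs w = length-filter≡∑𝟙 (_≟ₚ w) xs

-- Transpositions and cycles

module _ {n : ℕ} (a : ℕ) (a+1<n : suc a < n) where
  private
    â â+1 : Fin n
    â   = fromℕ< (<-trans (n<1+n a) a+1<n)
    â+1 = fromℕ< a+1<n

  s-transposes : ∀ k → s (suc a) ⟨$⟩ʳ k ≡ PC.transpose â â+1 k
  s-transposes k with suc a <? n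
  ... | yes _     = refl
  ... | no a+1≮n = ⊥-elim (a+1≮n a+1<n)

  s-raises : ∀ k → toℕ k ≡ a → toℕ (s (suc a) ⟨$⟩ʳ k) ≡ suc a
  s-raises k k≡a rewrite s-transposes k with k ≟ᶠ â
  ... | yes _   = toℕ-fromℕ< a+1<n
  ... | no k≢â = ⊥-elim (k≢â (toℕ-injective (trans k≡a (sym (toℕ-fromℕ< _)))))

  s-lowers : ∀ k → toℕ k ≡ suc a → toℕ (s (suc a) ⟨$⟩ʳ k) ≡ a
  s-lowers k k≡a+1 rewrite s-transposes k with k ≟ᶠ â
  ... | yes k≡â = ⊥-elim (1+n≢n (trans (sym k≡a+1) (trans (cong toℕ k≡â) (toℕ-fromℕ< _))))
  ... | no _ with k ≟ᶠ â+1
  ...   | yes _     = toℕ-fromℕ< _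
  ...   | no k≢â+1 = ⊥-elim (k≢â+1 (toℕ-injective (trans k≡a+1 (sym (toℕ-fromℕ< _)))))

  s-fixes : ∀ k → toℕ k ≢ a → toℕ k ≢ suc a → toℕ (s (suc a) ⟨$⟩ʳ k) ≡ toℕ k
  s-fixes k k≢a k≢a+1 rewrite s-transposes k with k ≟ᶠ â
  ... | yes k≡â = ⊥-elim (k≢a (trans (cong toℕ k≡â) (toℕ-fromℕ< _)))
  ... | no _ with k ≟ᶠ â+1
  ...   | yes k≡â+1 = ⊥-elim (k≢a+1 (trans (cong toℕ k≡â+1) (toℕ-fromℕ< _)))
  ...   | no _       = refl

  s-involutive : ∀ k → s (suc a) ⟨$⟩ʳ (s (suc a) ⟨$⟩ʳ k) ≡ k
  s-involutive k = toℕ-injective (twice (toℕ k ≟ a) (toℕ k ≟ suc a))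
    where
    twice : Dec (toℕ k ≡ a) → Dec (toℕ k ≡ suc a) → toℕ (s (suc a) ⟨$⟩ʳ (s (suc a) ⟨$⟩ʳ k)) ≡ toℕ k
    twice (yes k≡a) _ = trans (s-lowers _ (s-raises k k≡a)) (sym k≡a)
    twice (no _) (yes k≡a+1) = trans (s-raises _ (s-lowers k k≡a+1)) (sym k≡a+1)
    twice (no k≢a) (no k≢a+1) =
      trans (cong toℕ (cong (s (suc a) ⟨$⟩ʳ_) (toℕ-injective sk≡k))) sk≡k
      where sk≡k = s-fixes k k≢a k≢a+1

range-∷ : ∀ a b → a ≤ b → range a b ≡ a ∷ range (suc a) b
range-∷ a b a≤b = begin
  map (a +_) (upTo (suc b ∸ a))                ≡⟨ cong (map (a +_) ∘ upTo) (+-∸-assoc 1 a≤b) ⟩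
  a + 0 ∷ map (a +_) (applyUpTo suc (b ∸ a))   ≡⟨ cong₂ _∷_ (+-identityʳ a) (map-applyUpTo suc (a +_) (b ∸ a)) ⟩
  a ∷ applyUpTo (λ x → a + suc x) (b ∸ a)      ≡⟨ cong (a ∷_) (map-upTo _ (b ∸ a)) ⟨
  a ∷ map (λ x → a + suc x) (upTo (b ∸ a))     ≡⟨ cong (a ∷_) (map-cong (+-suc a) (upTo (b ∸ a))) ⟩
  a ∷ range (suc a) b                          ∎
  where open ≡-Reasoning

range-empty : ∀ b → range (suc b) b ≡ []
range-empty b = cong (map (suc b +_) ∘ upTo) (n∸n≡0 b)

word-++ : ∀ {n} (xs ys : List ℕ) k → word {n} (xs ++ ys) ⟨$⟩ʳ k ≡ word xs ⟨$⟩ʳ (word ys ⟨$⟩ʳ k)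
word-++ []       ys k = refl
word-++ (x ∷ xs) ys k = cong (s x ⟨$⟩ʳ_) (word-++ xs ys k)

-- cyc a M = s_{a+1} ⋯ s_M and cyc⁻¹ a M = s_M ⋯ s_{a+1} (a = 0, …, M) are the terms of 𝓑*_{M+1}
-- and 𝓑_{M+1}; on 0-based positions cyc a M is the cycle a ↦ a + 1 ↦ ⋯ ↦ M ↦ a.
cyc cyc⁻¹ : ∀ {n} → ℕ → ℕ → Perm n
cyc   a M = word (range (suc a) M)
cyc⁻¹ a M = word (rangeDown (suc a) M)

record IsCycle {n : ℕ} (a M : ℕ) (f : Fin n → Fin n) : Set where
  field
    last↦first  : ∀ k → toℕ k ≡ M → toℕ (f k) ≡ a
    fixes-below : ∀ k → toℕ k < a → toℕ (f k) ≡ toℕ k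
    shifts      : ∀ k → a ≤ toℕ k → toℕ k < M → toℕ (f k) ≡ suc (toℕ k)
    fixes-above : ∀ k → M < toℕ k → toℕ (f k) ≡ toℕ k

module _ {n a M : ℕ} {f : Fin n → Fin n} (f-cycle : IsCycle a M f) where
  open IsCycle f-cycle

  cycle-monotone : ∀ u v → toℕ u < toℕ v → toℕ v < M → toℕ (f u) < toℕ (f v)
  cycle-monotone u v u<v v<M with toℕ v <? a
  ... | yes v<a rewrite fixes-below v v<a | fixes-below u (<-trans u<v v<a) = u<v
  ... | no v≮a with toℕ u <? a
  ...   | yes u<a rewrite shifts v (≮⇒≥ v≮a) v<M | fixes-below u u<a = m<n⇒m<1+n u<v
  ...   | no u≮a  rewrite shifts v (≮⇒≥ v≮a) v<M | shifts u (≮⇒≥ u≮a) (<-trans u<v v<M) = s≤s u<v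

  cycle-<last⇔ : ∀ u → toℕ u < M ⇔ (toℕ (f u) ≤ M × toℕ (f u) ≢ a)
  cycle-<last⇔ u = mk⇔ to from
    where
    to : toℕ u < M → toℕ (f u) ≤ M × toℕ (f u) ≢ a
    to u<M with toℕ u <? a
    ... | yes u<a rewrite fixes-below u u<a = <⇒≤ u<M , <⇒≢ u<a
    ... | no u≮a  rewrite shifts u (≮⇒≥ u≮a) u<M = u<M , >⇒≢ (s≤s (≮⇒≥ u≮a))
    from : toℕ (f u) ≤ M × toℕ (f u) ≢ a → toℕ u < M
    from (fu≤M , fu≢a) with <-cmp (toℕ u) M
    ... | tri< u<M _ _ = u<M
    ... | tri≈ _ u≡M _ = ⊥-elim (fu≢a (last↦first u u≡M))
    ... | tri> _ _ M<u = ⊥-elim (<⇒≱ (subst (M <_) (sym (fixes-above u M<u)) M<u) fu≤M)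

module _ {n M : ℕ} (M<n : M < n) where

  private
    module Step {a : ℕ} (a<M : a < M) where
      a+1<n : suc a < n
      a+1<n = ≤-<-trans a<M M<n

      cyc-∷ : ∀ (k : Fin n) → cyc a M ⟨$⟩ʳ k ≡ s (suc a) ⟨$⟩ʳ (cyc (suc a) M ⟨$⟩ʳ k)
      cyc-∷ k = cong (λ ws → word ws ⟨$⟩ʳ k) (range-∷ (suc a) M a<M)

  cyc-isCycle : ∀ {a} → a ≤ M → IsCycle a M (cyc a M ⟨$⟩ʳ_)
  cyc-isCycle = downward-induction (λ a → IsCycle a M (cyc a M ⟨$⟩ʳ_)) cyc-M-isCycle step
    where
    cyc-M-isCycle : IsCycle M M (cyc M M ⟨$⟩ʳ_)
    cyc-M-isCycle rewrite range-empty M = record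
      { last↦first  = λ _ k≡M → k≡M
      ; fixes-below = λ _ _ → refl
      ; shifts      = λ _ M≤k k<M → ⊥-elim (<⇒≱ k<M M≤k)
      ; fixes-above = λ _ _ → refl
      }
    step : ∀ {a} → a < M → IsCycle (suc a) M (cyc (suc a) M ⟨$⟩ʳ_) → IsCycle a M (cyc a M ⟨$⟩ʳ_)
    step {a} a<M IH = record
      { last↦first  = λ k k≡M → unfold k (s-lowers a a+1<n (g k) (IH.last↦first k k≡M))
      ; fixes-below = λ k k<a → unfold k (fixes-below k k<a)
      ; shifts      = λ k a≤k k<M → unfold k (shifts k a≤k k<M)
      ; fixes-above = λ k M<k → unfold k (fixes-above k M<k)
      }
      where
      open Step a<M
      module IH = IsCycle IH
      g : Fin n → Fin n
      g k = cyc (suc a) M ⟨$⟩ʳ k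
      unfold : ∀ k {r} → toℕ (s (suc a) ⟨$⟩ʳ g k) ≡ r → toℕ (cyc a M ⟨$⟩ʳ k) ≡ r
      unfold k = trans (cong toℕ (cyc-∷ k))
      s-fixes-below : ∀ m → toℕ m < a → toℕ (s (suc a) ⟨$⟩ʳ m) ≡ toℕ m
      s-fixes-below m m<a = s-fixes a a+1<n m (<⇒≢ m<a) (<⇒≢ (m<n⇒m<1+n m<a))
      s-fixes-above : ∀ m → suc a < toℕ m → toℕ (s (suc a) ⟨$⟩ʳ m) ≡ toℕ m
      s-fixes-above m a+1<m = s-fixes a a+1<n m (>⇒≢ (<-trans (n<1+n a) a+1<m)) (>⇒≢ a+1<m)
      fixes-below : ∀ k → toℕ k < a → toℕ (s (suc a) ⟨$⟩ʳ g k) ≡ toℕ k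
      fixes-below k k<a = trans (cong (λ m → toℕ (s (suc a) ⟨$⟩ʳ m)) gk≡k) (s-fixes-below k k<a)
        where gk≡k = toℕ-injective (IH.fixes-below k (m<n⇒m<1+n k<a))
      shifts : ∀ k → a ≤ toℕ k → toℕ k < M → toℕ (s (suc a) ⟨$⟩ʳ g k) ≡ suc (toℕ k)
      shifts k a≤k k<M with toℕ k ≟ a
      ... | yes k≡a = trans (s-raises a a+1<n (g k) (trans (IH.fixes-below k (subst (_< suc a) (sym k≡a) (n<1+n a))) k≡a)) (cong suc (sym k≡a))
      ... | no k≢a  = trans (s-fixes-above (g k) (subst (suc a <_) (sym gk≡k+1) (s≤s a+1≤k))) gk≡k+1
        where
        a+1≤k = ≤∧≢⇒< a≤k (k≢a ∘ sym)
        gk≡k+1 = IH.shifts k a+1≤k k<M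
      fixes-above : ∀ k → M < toℕ k → toℕ (s (suc a) ⟨$⟩ʳ g k) ≡ toℕ k
      fixes-above k M<k = trans (s-fixes-above (g k) (subst (suc a <_) (sym gk≡k) (≤-<-trans a<M M<k))) gk≡k
        where gk≡k = IH.fixes-above k M<k

  cyc⁻¹-cyc : ∀ {a} → a ≤ M → ∀ k → cyc⁻¹ a M ⟨$⟩ʳ (cyc a M ⟨$⟩ʳ k) ≡ k
  cyc⁻¹-cyc = downward-induction (λ a → ∀ k → cyc⁻¹ a M ⟨$⟩ʳ (cyc a M ⟨$⟩ʳ k) ≡ k) cyc⁻¹-cyc-M step
    where
    cyc⁻¹-cyc-M : ∀ k → cyc⁻¹ M M ⟨$⟩ʳ (cyc M M ⟨$⟩ʳ k) ≡ k
    cyc⁻¹-cyc-M k rewrite range-empty M = refl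
    step : ∀ {a} → a < M → (∀ k → cyc⁻¹ (suc a) M ⟨$⟩ʳ (cyc (suc a) M ⟨$⟩ʳ k) ≡ k) →
           ∀ k → cyc⁻¹ a M ⟨$⟩ʳ (cyc a M ⟨$⟩ʳ k) ≡ k
    step {a} a<M IH k rewrite range-∷ (suc a) M a<M = begin
      word (rangeDown (suc (suc a)) M ++ suc a ∷ []) ⟨$⟩ʳ (s (suc a) ⟨$⟩ʳ (cyc (suc a) M ⟨$⟩ʳ k))
        ≡⟨ word-++ (rangeDown (suc (suc a)) M) (suc a ∷ []) _ ⟩
      cyc⁻¹ (suc a) M ⟨$⟩ʳ (s (suc a) ⟨$⟩ʳ (s (suc a) ⟨$⟩ʳ (cyc (suc a) M ⟨$⟩ʳ k)))
        ≡⟨ cong (cyc⁻¹ (suc a) M ⟨$⟩ʳ_) (s-involutive a (Step.a+1<n a<M) _) ⟩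
      cyc⁻¹ (suc a) M ⟨$⟩ʳ (cyc (suc a) M ⟨$⟩ʳ k)
        ≡⟨ IH k ⟩
      k ∎
      where open ≡-Reasoning

module _ {n M a : ℕ} (M<n : M < n) (a≤M : a ≤ M) where
  private
    c c⁻¹ : Fin n → Fin n
    c   = cyc a M ⟨$⟩ʳ_
    c⁻¹ = cyc⁻¹ a M ⟨$⟩ʳ_

  cyc-cyc⁻¹ : ∀ v → c (c⁻¹ v) ≡ v
  cyc-cyc⁻¹ v = ⟨$⟩ʳ-injective (cyc⁻¹ a M) (cyc⁻¹-cyc M<n a≤M (c⁻¹ v))

  cyc⁻¹-<last⇔ : ∀ v → toℕ (c⁻¹ v) < M ⇔ (toℕ v ≤ M × toℕ v ≢ a)
  cyc⁻¹-<last⇔ v = subst (λ w → toℕ (c⁻¹ v) < M ⇔ (toℕ w ≤ M × toℕ w ≢ a)) (cyc-cyc⁻¹ v)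
    (cycle-<last⇔ (cyc-isCycle M<n a≤M) (c⁻¹ v))

  cyc⁻¹-reflects-< : ∀ u v → toℕ (c⁻¹ u) < toℕ (c⁻¹ v) → toℕ (c⁻¹ v) < M → toℕ u < toℕ v
  cyc⁻¹-reflects-< u v c⁻¹u<c⁻¹v c⁻¹v<M = subst₂ (λ x y → toℕ x < toℕ y) (cyc-cyc⁻¹ u) (cyc-cyc⁻¹ v)
    (cycle-monotone (cyc-isCycle M<n a≤M) (c⁻¹ u) (c⁻¹ v) c⁻¹u<c⁻¹v c⁻¹v<M)

∑-𝓑 : ∀ {n} M (f : Perm n → ℕ) → ∑ (𝓑 (suc M)) f ≡ ∑ (upTo (suc M)) (λ a → f (cyc⁻¹ a M))
∑-𝓑 M f = trans (∑-map _ (range 1 (suc M)) f) (∑-map suc (upTo (suc M)) _)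

∑-𝓑* : ∀ {n} M (f : Perm n → ℕ) → ∑ (𝓑* (suc M)) f ≡ ∑ (upTo (suc M)) (λ a → f (cyc a M))
∑-𝓑* M f = trans (∑-map _ (range 1 (suc M)) f) (∑-map suc (upTo (suc M)) _)

module _ {n j : ℕ} (j<n : j < n) where
  private
    range-∷-M : range (suc (n ∸ suc j)) n ≡ suc (n ∸ suc j) ∷ range (suc (n ∸ j)) n
    range-∷-M = trans (range-∷ _ n (m∸[1+n]<m j<n))
                      (cong (λ m → suc (n ∸ suc j) ∷ range (suc m) n) (sym (m∸n≡1+m∸[1+n] j<n)))

  ∑-𝓑nk-suc : (f : Perm n → ℕ) →
              ∑ (𝓑nk n (suc j)) f ≡ ∑ (upTo (suc (n ∸ suc j))) (λ a → ∑ (𝓑nk n j) (λ y → f (cyc⁻¹ a (n ∸ suc j) · y)))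
  ∑-𝓑nk-suc f = begin
    ∑ (𝓑nk n (suc j)) f
      ≡⟨ cong (λ l → ∑ (prodAlg (map 𝓑 l)) f) range-∷-M ⟩
    ∑ (𝓑 (suc (n ∸ suc j)) ⊗ 𝓑nk n j) f
      ≡⟨ ∑-⊗ (𝓑 (suc (n ∸ suc j))) (𝓑nk n j) f ⟩
    ∑ (𝓑 (suc (n ∸ suc j))) (λ x → ∑ (𝓑nk n j) (λ y → f (x · y)))
      ≡⟨ ∑-𝓑 (n ∸ suc j) _ ⟩
    ∑ (upTo (suc (n ∸ suc j))) (λ a → ∑ (𝓑nk n j) (λ y → f (cyc⁻¹ a (n ∸ suc j) · y)))
      ∎
    where open ≡-Reasoning

  ∑-𝓑*nk-suc : (f : Perm n → ℕ) → f Preserves _≈ₚ_ ⟶ _≡_ →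
               ∑ (𝓑*nk n (suc j)) f ≡ ∑ (𝓑*nk n j) (λ x → ∑ (upTo (suc (n ∸ suc j))) (λ a → f (x · cyc a (n ∸ suc j))))
  ∑-𝓑*nk-suc f f-resp = begin
    ∑ (𝓑*nk n (suc j)) f
      ≡⟨ cong (λ l → ∑ (prodAlg (map 𝓑* (foldr (λ x acc → acc ++ x ∷ []) [] l))) f) range-∷-M ⟩
    ∑ (prodAlg (map 𝓑* (rangeDown (suc (n ∸ j)) n ∷ʳ suc (n ∸ suc j)))) f
      ≡⟨ cong (λ As → ∑ (prodAlg As) f) (map-++ 𝓑* (rangeDown (suc (n ∸ j)) n) _) ⟩
    ∑ (prodAlg (map 𝓑* (rangeDown (suc (n ∸ j)) n) ∷ʳ 𝓑* (suc (n ∸ suc j)))) f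
      ≡⟨ ∑-prodAlg-∷ʳ (map 𝓑* (rangeDown (suc (n ∸ j)) n)) (𝓑* (suc (n ∸ suc j))) f f-resp ⟩
    ∑ (𝓑*nk n j) (λ x → ∑ (𝓑* (suc (n ∸ suc j))) (λ b → f (x · b)))
      ≡⟨ ∑-cong (𝓑*nk n j) (λ x → ∑-𝓑* (n ∸ suc j) _) ⟩
    ∑ (𝓑*nk n j) (λ x → ∑ (upTo (suc (n ∸ suc j))) (λ a → f (x · cyc a (n ∸ suc j))))
      ∎
    where open ≡-Reasoning

-- Permutations increasing on an initial segment

IsCut : (ℕ → Set) → ℕ → ℕ → Set
IsCut P M a = (∀ i → i < a → P i) × (∀ i → a ≤ i → i < M → ¬ P i)

∑-unique-cut : ∀ M {P : ℕ → Set} → (∀ i → Dec (P i)) → (∀ {i j} → i ≤ j → j < M → P j → P i) →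
               (g : ℕ → ℕ) → (∀ a → a ≤ M → IsCut P M a → g a ≡ 1) → (∀ a → a ≤ M → ¬ IsCut P M a → g a ≡ 0) →
               ∑ (upTo (suc M)) g ≡ 1
∑-unique-cut zero P? P-closed g cut⇒1 ¬cut⇒0 = cong (_+ 0) (cut⇒1 0 z≤n ((λ _ ()) , (λ _ _ ())))
∑-unique-cut (suc M) {P} P? P-closed g cut⇒1 ¬cut⇒0 with P? 0
... | yes P0 = trans (∑-upTo-suc (suc M) g) (cong₂ _+_ g0≡0
      (∑-unique-cut M (P? ∘ suc) (λ i≤j j<M → P-closed (s≤s i≤j) (s≤s j<M)) (g ∘ suc)
        (λ a a≤M cut → cut⇒1 (suc a) (s≤s a≤M) (shift⇒ cut))
        (λ a a≤M ¬cut → ¬cut⇒0 (suc a) (s≤s a≤M) (¬cut ∘ shift⇐))))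
  where
  g0≡0 : g 0 ≡ 0
  g0≡0 = ¬cut⇒0 0 z≤n (λ (_ , ¬P) → ¬P 0 z≤n (s≤s z≤n) P0)
  shift⇒ : ∀ {a} → IsCut (P ∘ suc) M a → IsCut P (suc M) (suc a)
  shift⇒ (below , above) = (λ { zero _ → P0 ; (suc i) (s≤s i<a) → below i i<a })
                         , (λ { (suc i) (s≤s a≤i) (s≤s i<M) → above i a≤i i<M })
  shift⇐ : ∀ {a} → IsCut P (suc M) (suc a) → IsCut (P ∘ suc) M a
  shift⇐ (below , above) = (λ i i<a → below (suc i) (s≤s i<a)) , (λ i a≤i i<M → above (suc i) (s≤s a≤i) (s≤s i<M))
... | no ¬P0 = trans (∑-upTo-suc (suc M) g) (cong₂ _+_ g0≡1
      (∑-upTo-zero (suc M) (g ∘ suc) (λ x x<M+1 → ¬cut⇒0 (suc x) x<M+1 (λ (below , _) → ¬P0 (below 0 (s≤s z≤n))))))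
  where
  g0≡1 : g 0 ≡ 1
  g0≡1 = cut⇒1 0 z≤n ((λ _ ()) , (λ i _ i<M+1 Pi → ¬P0 (P-closed z≤n i<M+1 Pi)))

IncreasingBelow : ∀ {n} → ℕ → Perm n → Set
IncreasingBelow {n} t z = ∀ (p q : Fin n) → toℕ q < t → toℕ p < toℕ q → toℕ (z ⟨$⟩ʳ p) < toℕ (z ⟨$⟩ʳ q)

increasingBelow? : ∀ {n} t (z : Perm n) → Dec (IncreasingBelow t z)
increasingBelow? t z = all? λ p → all? λ q →
  (toℕ q <? t) →-dec (toℕ p <? toℕ q) →-dec (toℕ (z ⟨$⟩ʳ p) <? toℕ (z ⟨$⟩ʳ q))

IncreasingAlong : ∀ {n} → ℕ → Perm n → Perm n → Set
IncreasingAlong {n} t b z =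
  ∀ (p q : Fin n) → toℕ (b ⟨$⟩ʳ q) < t → toℕ (b ⟨$⟩ʳ p) < toℕ (b ⟨$⟩ʳ q) → toℕ (z ⟨$⟩ʳ p) < toℕ (z ⟨$⟩ʳ q)

InverseIncreasingBelow : ∀ {n} → ℕ → Perm n → Set
InverseIncreasingBelow t y = IncreasingAlong t y id

increasingBelow-·⁻¹⇔ : ∀ {n} t (z b : Perm n) → IncreasingBelow t (z · flip b) ⇔ IncreasingAlong t b z
increasingBelow-·⁻¹⇔ t z b = mk⇔
  (λ inc p q bq<t bp<bq → subst₂ (λ x y → toℕ (z ⟨$⟩ʳ x) < toℕ (z ⟨$⟩ʳ y)) (inverseˡ b) (inverseˡ b)
                             (inc (b ⟨$⟩ʳ p) (b ⟨$⟩ʳ q) bq<t bp<bq))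
  (λ along p q q<t p<q → along (b ⟨$⟩ˡ p) (b ⟨$⟩ˡ q) (subst (λ x → toℕ x < t) (sym (inverseʳ b)) q<t)
                             (subst₂ (λ x y → toℕ x < toℕ y) (sym (inverseʳ b)) (sym (inverseʳ b)) p<q))

-- On positions 0, …, M, z · (cyc a M)⁻¹ reads z(0), …, z(a − 1), z(M), z(a), …, z(M − 1), so it is
-- increasing iff z is increasing below M and a is the cut of BelowLast, the slot where z(M) belongs.
module _ {n M : ℕ} (M<n : M < n) (z : Perm n) where
  private
    M̂ : Fin n
    M̂ = fromℕ< M<n
    M̂≡M : toℕ M̂ ≡ M
    M̂≡M = toℕ-fromℕ< M<n
    ẑ : Fin n → ℕ
    ẑ p = toℕ (z ⟨$⟩ʳ p)

  BelowLast : ℕ → Set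
  BelowLast i = ∀ p → toℕ p ≡ i → ẑ p < ẑ M̂

  belowLast? : ∀ i → Dec (BelowLast i)
  belowLast? i = all? λ p → (toℕ p ≟ i) →-dec (ẑ p <? ẑ M̂)

  belowLast-closed : IncreasingBelow M z → ∀ {i j} → i ≤ j → j < M → BelowLast j → BelowLast i
  belowLast-closed inc {i} {j} i≤j j<M below-j p p≡i with m≤n⇒m<n∨m≡n i≤j
  ... | inj₂ i≡j = below-j p (trans p≡i i≡j)
  ... | inj₁ i<j = <-trans (inc p ĵ (subst (_< M) (sym ĵ≡j) j<M) (subst₂ _<_ (sym p≡i) (sym ĵ≡j) i<j)) (below-j ĵ ĵ≡j)
    where
    ĵ = fromℕ< (<-trans j<M M<n)
    ĵ≡j = toℕ-fromℕ< (<-trans j<M M<n)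

  module _ {a : ℕ} (a≤M : a ≤ M) where
    private
      b : Fin n → Fin n
      b = cyc a M ⟨$⟩ʳ_
      open IsCycle (cyc-isCycle M<n a≤M)
      bM̂≡a : toℕ (b M̂) ≡ a
      bM̂≡a = last↦first M̂ M̂≡M

    along-cyc⇒increasingBelow : IncreasingAlong (suc M) (cyc a M) z → IncreasingBelow M z
    along-cyc⇒increasingBelow along p q q<M p<q =
      along p q (s≤s (proj₁ (Equivalence.to (cycle-<last⇔ (cyc-isCycle M<n a≤M) q) q<M)))
                (cycle-monotone (cyc-isCycle M<n a≤M) p q p<q q<M)

    along-cyc⇒cut : IncreasingAlong (suc M) (cyc a M) z → IsCut BelowLast M a
    along-cyc⇒cut along = below , above
      where
      below : ∀ i → i < a → BelowLast i
      below i i<a p p≡i = along p M̂ (s≤s (subst (_≤ M) (sym bM̂≡a) a≤M))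
        (subst₂ _<_ (sym (fixes-below p p<a)) (sym bM̂≡a) p<a)
        where p<a = subst (_< a) (sym p≡i) i<a
      above : ∀ i → a ≤ i → i < M → ¬ BelowLast i
      above i a≤i i<M below-i = <-asym (below-i î î≡i)
        (along M̂ î (s≤s (subst (_≤ M) (sym bî≡i+1) i<M)) (subst₂ _<_ (sym bM̂≡a) (sym bî≡i+1) (s≤s a≤i)))
        where
        î = fromℕ< (<-trans i<M M<n)
        î≡i = toℕ-fromℕ< (<-trans i<M M<n)
        bî≡i+1 : toℕ (b î) ≡ suc i
        bî≡i+1 = trans (shifts î (subst (a ≤_) (sym î≡i) a≤i) (subst (_< M) (sym î≡i) i<M)) (cong suc î≡i)

    increasingBelow×cut⇒along-cyc : IncreasingBelow M z → IsCut BelowLast M a → IncreasingAlong (suc M) (cyc a M) z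
    increasingBelow×cut⇒along-cyc inc (below , above) p q bq<M+1 bp<bq
      with position q (≤-pred bq<M+1) | position p (<⇒≤ (<-≤-trans bp<bq (≤-pred bq<M+1)))
      where
      position : ∀ p → toℕ (b p) ≤ M → p ≡ M̂ ⊎ toℕ p < M
      position p bp≤M with toℕ (b p) ≟ a
      ... | yes bp≡a = inj₁ (⟨$⟩ʳ-injective (cyc a M) (toℕ-injective (trans bp≡a (sym bM̂≡a))))
      ... | no bp≢a  = inj₂ (Equivalence.from (cycle-<last⇔ (cyc-isCycle M<n a≤M) p) (bp≤M , bp≢a))
    ... | inj₁ refl | inj₁ refl = ⊥-elim (<-irrefl refl bp<bq)
    ... | inj₁ refl | inj₂ p<M with toℕ p <? a
    ...   | yes p<a = below (toℕ p) p<a p refl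
    ...   | no p≮a  = ⊥-elim (<-asym (subst₂ _<_ (shifts p (≮⇒≥ p≮a) p<M) bM̂≡a bp<bq) (s≤s (≮⇒≥ p≮a)))
    increasingBelow×cut⇒along-cyc inc (below , above) p q bq<M+1 bp<bq
      | inj₂ q<M | inj₁ refl with toℕ q <? a
    ...   | yes q<a = ⊥-elim (<-asym q<a (subst₂ _<_ bM̂≡a (fixes-below q q<a) bp<bq))
    ...   | no q≮a with <-cmp (ẑ q) (ẑ M̂)
    ...     | tri< zq<zM _ _ = ⊥-elim (above (toℕ q) (≮⇒≥ q≮a) q<M
                                 (λ p' p'≡q → subst (λ x → ẑ x < ẑ M̂) (toℕ-injective (sym p'≡q)) zq<zM))
    ...     | tri≈ _ zq≡zM _ = ⊥-elim (<-irrefl (trans (cong toℕ (⟨$⟩ʳ-injective z (toℕ-injective zq≡zM))) M̂≡M) q<M)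
    ...     | tri> _ _ zM<zq = zM<zq
    increasingBelow×cut⇒along-cyc inc (below , above) p q bq<M+1 bp<bq
      | inj₂ q<M | inj₂ p<M with <-cmp (toℕ p) (toℕ q)
    ...   | tri< p<q _ _ = inc p q q<M p<q
    ...   | tri≈ _ p≡q _ = ⊥-elim (<-irrefl (cong (toℕ ∘ b) (toℕ-injective p≡q)) bp<bq)
    ...   | tri> _ _ q<p = ⊥-elim (<-asym bp<bq (cycle-monotone (cyc-isCycle M<n a≤M) q p q<p p<M))

  ∑-cyc-increasingBelow : ∑ (upTo (suc M)) (λ a → 𝟙 (increasingBelow? (suc M) (z · flip (cyc a M))))
                          ≡ 𝟙 (increasingBelow? M z)
  ∑-cyc-increasingBelow = by-cases (increasingBelow? M z)
    where
    along⇔ : ∀ a → IncreasingBelow (suc M) (z · flip (cyc a M)) ⇔ IncreasingAlong (suc M) (cyc a M) z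
    along⇔ a = increasingBelow-·⁻¹⇔ (suc M) z (cyc a M)
    g : ℕ → ℕ
    g a = 𝟙 (increasingBelow? (suc M) (z · flip (cyc a M)))
    g≡1 : ∀ a → IncreasingAlong (suc M) (cyc a M) z → g a ≡ 1
    g≡1 a along = 𝟙-yes (increasingBelow? (suc M) (z · flip (cyc a M))) (Equivalence.from (along⇔ a) along)
    g≡0 : ∀ a → ¬ IncreasingAlong (suc M) (cyc a M) z → g a ≡ 0
    g≡0 a ¬along = 𝟙-no (increasingBelow? (suc M) (z · flip (cyc a M))) (¬along ∘ Equivalence.to (along⇔ a))
    by-cases : (inc? : Dec (IncreasingBelow M z)) → ∑ (upTo (suc M)) g ≡ 𝟙 inc?
    by-cases (yes inc) = ∑-unique-cut M belowLast? (belowLast-closed inc) g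
      (λ a a≤M cut → g≡1 a (increasingBelow×cut⇒along-cyc a≤M inc cut))
      (λ a a≤M ¬cut → g≡0 a (¬cut ∘ along-cyc⇒cut a≤M))
    by-cases (no ¬inc) = ∑-upTo-zero (suc M) g λ a a<M+1 →
      g≡0 a (¬inc ∘ along-cyc⇒increasingBelow (≤-pred a<M+1))

module _ {n : ℕ} (z : Perm n) (inc : IncreasingBelow n z) where

  increasing⇒≤ : ∀ k (p : Fin n) → toℕ p ≡ k → k ≤ toℕ (z ⟨$⟩ʳ p)
  increasing⇒≤ zero    p _    = z≤n
  increasing⇒≤ (suc k) p p≡k+1 = ≤-<-trans (increasing⇒≤ k p' p'≡k) (inc p' p (toℕ<n p) (subst₂ _<_ (sym p'≡k) (sym p≡k+1) (n<1+n k)))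
    where
    k<n : k < n
    k<n = <-trans (n<1+n k) (subst (_< n) p≡k+1 (toℕ<n p))
    p' = fromℕ< k<n
    p'≡k = toℕ-fromℕ< k<n

  increasing⇒inverse-increasing : IncreasingBelow n (flip z)
  increasing⇒inverse-increasing p q _ p<q with <-cmp (toℕ (z ⟨$⟩ˡ p)) (toℕ (z ⟨$⟩ˡ q))
  ... | tri< lt _ _ = lt
  ... | tri≈ _ eq _ = ⊥-elim (<-irrefl (cong toℕ (trans (sym (inverseʳ z)) (trans (cong (z ⟨$⟩ʳ_) (toℕ-injective eq)) (inverseʳ z)))) p<q)
  ... | tri> _ _ gt = ⊥-elim (<-asym p<q (subst₂ _<_ (cong toℕ (inverseʳ z)) (cong toℕ (inverseʳ z)) (inc _ _ (toℕ<n _) gt)))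

increasing⇒id : ∀ {n} (z : Perm n) → IncreasingBelow n z → ∀ i → id ⟨$⟩ʳ i ≡ z ⟨$⟩ʳ i
increasing⇒id z inc i = toℕ-injective (≤-antisym (increasing⇒≤ z inc (toℕ i) i refl)
  (subst (toℕ (z ⟨$⟩ʳ i) ≤_) (cong toℕ (inverseˡ z))
    (increasing⇒≤ (flip z) (increasing⇒inverse-increasing z inc) (toℕ (z ⟨$⟩ʳ i)) (z ⟨$⟩ʳ i) refl)))

coeff-𝓑*nk : ∀ n j → j ≤ n → (z : Perm n) → coeff (𝓑*nk n j) z ≡ 𝟙 (increasingBelow? (n ∸ j) z)
coeff-𝓑*nk n zero _ z rewrite range-empty n =
  trans (coeff≡∑ one z) (trans (+-identityʳ _) (𝟙-⇔ (mk⇔ id≈z⇒increasing (increasing⇒id z)) (id ≟ₚ z) (increasingBelow? n z)))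
  where
  id≈z⇒increasing : id ≈ₚ z → IncreasingBelow n z
  id≈z⇒increasing id≈z p q _ p<q = subst₂ (λ x y → toℕ x < toℕ y) (id≈z p) (id≈z q) p<q
coeff-𝓑*nk n (suc j) j<n z = begin
  coeff (𝓑*nk n (suc j)) z
    ≡⟨ coeff≡∑ (𝓑*nk n (suc j)) z ⟩
  ∑ (𝓑*nk n (suc j)) (δ z)
    ≡⟨ ∑-𝓑*nk-suc {n} {j} j<n (δ z) (λ {x} {y} → 𝟙-≟ₚ-resp z {x} {y}) ⟩
  ∑ (𝓑*nk n j) (λ x → ∑ (upTo (suc M)) (λ a → δ z (x · cyc a M)))
    ≡⟨ ∑-swap (𝓑*nk n j) (upTo (suc M)) _ ⟩
  ∑ (upTo (suc M)) (λ a → ∑ (𝓑*nk n j) (λ x → δ z (x · cyc a M)))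
    ≡⟨ ∑-cong (upTo (suc M)) (λ a → ∑-cong (𝓑*nk n j) (λ x → 𝟙-≟ₚ-·-flip x (cyc a M) z)) ⟩
  ∑ (upTo (suc M)) (λ a → ∑ (𝓑*nk n j) (δ (z · flip (cyc a M))))
    ≡⟨ ∑-cong (upTo (suc M)) (λ a → trans (sym (coeff≡∑ (𝓑*nk n j) (z · flip (cyc a M)))) (coeff-𝓑*nk n j (<⇒≤ j<n) (z · flip (cyc a M)))) ⟩
  ∑ (upTo (suc M)) (λ a → 𝟙 (increasingBelow? (n ∸ j) (z · flip (cyc a M))))
    ≡⟨ cong (λ t → ∑ (upTo (suc M)) (λ a → 𝟙 (increasingBelow? t (z · flip (cyc a M))))) (m∸n≡1+m∸[1+n] j<n) ⟩
  ∑ (upTo (suc M)) (λ a → 𝟙 (increasingBelow? (suc M) (z · flip (cyc a M))))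
    ≡⟨ ∑-cyc-increasingBelow (m∸[1+n]<m j<n) z ⟩
  𝟙 (increasingBelow? M z)
    ∎
  where
  open ≡-Reasoning
  M = n ∸ suc j
  δ : Perm n → Perm n → ℕ
  δ z x = 𝟙 (x ≟ₚ z)

-- Double counting of subsets

∑Subsets : ∀ n → ℕ → (Subset n → ℕ) → ℕ
∑Subsets n r F = ∑ (allSubsets n) (λ U → 𝟙 (∣ U ∣ ≟ r) * F U)

∑Removals : ∀ {n} → (Subset n → ℕ) → Subset n → ℕ
∑Removals F V = ∑ᶠ (λ x → 𝟙 (x ∈? V) * F (V - x))

module _ {n : ℕ} where

  ∑Subsets-cong : ∀ r {F G : Subset n → ℕ} → (∀ U → F U ≡ G U) → ∑Subsets n r F ≡ ∑Subsets n r G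
  ∑Subsets-cong r F≗G = ∑-cong (allSubsets n) (λ U → cong (𝟙 (∣ U ∣ ≟ r) *_) (F≗G U))

  ∑Subsets-+ : ∀ r (F G : Subset n → ℕ) → ∑Subsets n r (λ U → F U + G U) ≡ ∑Subsets n r F + ∑Subsets n r G
  ∑Subsets-+ r F G = trans (∑-cong (allSubsets n) (λ U → *-distribˡ-+ (𝟙 (∣ U ∣ ≟ r)) (F U) (G U)))
                           (∑-+ (allSubsets n) _ _)

  ∑Subsets-∷ : ∀ r (F : Subset (suc n) → ℕ) → ∑Subsets (suc n) r F ≡
    ∑ (allSubsets n) (λ U → 𝟙 (suc ∣ U ∣ ≟ r) * F (inside ∷ U)) + ∑Subsets n r (λ U → F (outside ∷ U))
  ∑Subsets-∷ r F =
    trans (∑-++ (map (inside ∷_) (allSubsets n)) (map (outside ∷_) (allSubsets n)) _)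
          (cong₂ _+_ (∑-map (inside ∷_) (allSubsets n) _) (∑-map (outside ∷_) (allSubsets n) _))

  ∑Subsets-suc : ∀ r (F : Subset (suc n) → ℕ) →
    ∑Subsets (suc n) (suc r) F ≡ ∑Subsets n r (λ U → F (inside ∷ U)) + ∑Subsets n (suc r) (λ U → F (outside ∷ U))
  ∑Subsets-suc r F = ∑Subsets-∷ (suc r) F

  ∑Subsets-zero : ∀ (F : Subset (suc n) → ℕ) → ∑Subsets (suc n) 0 F ≡ ∑Subsets n 0 (λ U → F (outside ∷ U))
  ∑Subsets-zero F = trans (∑Subsets-∷ 0 F) (cong (_+ ∑Subsets n 0 (λ U → F (outside ∷ U))) (∑-zero (allSubsets n)))

  ∑Removals-inside : ∀ (F : Subset (suc n) → ℕ) V →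
    ∑Removals F (inside ∷ V) ≡ F (outside ∷ V) + ∑Removals (λ U → F (inside ∷ U)) V
  ∑Removals-inside F V = cong (_+ ∑Removals (λ U → F (inside ∷ U)) V) (trans (+-identityʳ _) (cong (F ∘ (outside ∷_)) (p─⊥≡p V)))

∑Subsets-> : ∀ n r (F : Subset n → ℕ) → n < r → ∑Subsets n r F ≡ 0
∑Subsets-> zero    (suc r) F _         = refl
∑Subsets-> (suc n) (suc r) F (s≤s n<r) = trans (∑Subsets-suc r F)
  (cong₂ _+_ (∑Subsets-> n r _ n<r) (∑Subsets-> n (suc r) _ (m<n⇒m<1+n n<r)))

∑Subsets-⊤ : ∀ n (F : Subset n → ℕ) → ∑Subsets n n F ≡ F ⊤
∑Subsets-⊤ zero    F = trans (+-identityʳ _) (*-identityˡ _)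
∑Subsets-⊤ (suc n) F = trans (∑Subsets-suc n F)
  (trans (cong₂ _+_ (∑Subsets-⊤ n _) (∑Subsets-> n (suc n) _ (n<1+n n))) (+-identityʳ _))

∑Removals-∅ : ∀ {n} (F : Subset n → ℕ) V → ∣ V ∣ ≡ 0 → ∑Removals F V ≡ 0
∑Removals-∅ F []            _      = refl
∑Removals-∅ F (outside ∷ V) ∣V∣≡0 = ∑Removals-∅ (F ∘ (outside ∷_)) V ∣V∣≡0

∑Subsets-∑Removals-zero : ∀ n (F : Subset n → ℕ) → ∑Subsets n 0 (∑Removals F) ≡ 0
∑Subsets-∑Removals-zero n F = trans (∑-cong (allSubsets n) term≡0) (∑-zero (allSubsets n))
  where
  term≡0 : ∀ U → 𝟙 (∣ U ∣ ≟ 0) * ∑Removals F U ≡ 0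
  term≡0 U with ∣ U ∣ ≟ 0
  ... | yes ∣U∣≡0 = trans (cong (_* ∑Removals F U) (𝟙-yes (∣ U ∣ ≟ 0) ∣U∣≡0))
                          (trans (+-identityʳ _) (∑Removals-∅ F U ∣U∣≡0))
  ... | no ∣U∣≢0  = cong (_* ∑Removals F U) (𝟙-no (∣ U ∣ ≟ 0) ∣U∣≢0)

-- An r-subset V arises as U - x with x ∈ U and ∣ U ∣ = r + 1 exactly for the n − r points x ∉ V.
∑Subsets-∑Removals : ∀ n (F : Subset n → ℕ) r → ∑Subsets n (suc r) (∑Removals F) ≡ (n ∸ r) * ∑Subsets n r F
∑Subsets-∑Removals zero    F r = cong (_* ∑Subsets zero r F) (sym (0∸n≡0 r))
∑Subsets-∑Removals (suc n) F r = begin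
  ∑Subsets (suc n) (suc r) (∑Removals F)
    ≡⟨ ∑Subsets-suc r (∑Removals F) ⟩
  ∑Subsets n r (λ U → ∑Removals F (inside ∷ U)) + ∑Subsets n (suc r) (∑Removals Fₒ)
    ≡⟨ cong₂ _+_ (trans (∑Subsets-cong r (∑Removals-inside F)) (∑Subsets-+ r Fₒ (∑Removals Fᵢ)))
                 (∑Subsets-∑Removals n Fₒ r) ⟩
  ∑Subsets n r Fₒ + ∑Subsets n r (∑Removals Fᵢ) + (n ∸ r) * ∑Subsets n r Fₒ
    ≡⟨ by-cases r ⟩
  (suc n ∸ r) * ∑Subsets (suc n) r F
    ∎
  where
  open ≡-Reasoning
  open +-*-Solver
  Fᵢ Fₒ : Subset n → ℕ
  Fᵢ U = F (inside ∷ U)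
  Fₒ U = F (outside ∷ U)
  by-cases : ∀ r → ∑Subsets n r Fₒ + ∑Subsets n r (∑Removals Fᵢ) + (n ∸ r) * ∑Subsets n r Fₒ
                   ≡ (suc n ∸ r) * ∑Subsets (suc n) r F
  by-cases zero rewrite ∑Subsets-zero F | ∑Subsets-∑Removals-zero n Fᵢ =
    solve 2 (λ x m → x :+ con 0 :+ m :* x := x :+ m :* x) refl (∑Subsets n 0 Fₒ) n
  by-cases (suc r) rewrite ∑Subsets-suc r F | ∑Subsets-∑Removals n Fᵢ r with suc r ≤? n
  ... | yes r<n rewrite m∸n≡1+m∸[1+n] r<n =
    solve 3 (λ x y k → x :+ (con 1 :+ k) :* y :+ k :* x := (con 1 :+ k) :* (y :+ x)) refl
      (∑Subsets n (suc r) Fₒ) (∑Subsets n r Fᵢ) (n ∸ suc r)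
  ... | no r≮n rewrite ∑Subsets-> n (suc r) Fₒ (≰⇒> r≮n) =
    solve 3 (λ k y l → con 0 :+ k :* y :+ l :* con 0 := k :* (y :+ con 0)) refl (n ∸ r) (∑Subsets n r Fᵢ) (n ∸ suc r)

-- 𝓑_{n,j} and preimages of initial segments

subset-ext : ∀ {n} {p q : Subset n} → (∀ i → i ∈ p ⇔ i ∈ q) → p ≡ q
subset-ext p⇔q = ⊆-antisym (Equivalence.to (p⇔q _)) (Equivalence.from (p⇔q _))

x∉p-x : ∀ {n} (p : Subset n) x → x ∉ p - x
x∉p-x (inside  ∷ p) zero    ()
x∉p-x (outside ∷ p) zero    ()
x∉p-x (_       ∷ p) (suc x) x∈p-x = x∉p-x p x (drop-there x∈p-x)

∈-remove⇔ : ∀ {n} {p : Subset n} {x i} → i ∈ p - x ⇔ (i ∈ p × i ≢ x)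
∈-remove⇔ {p = p} {x} = mk⇔
  (λ i∈p-x → p─q⊆p p ⁅ x ⁆ i∈p-x , λ { refl → x∉p-x p x i∈p-x })
  (λ (i∈p , i≢x) → x∈p∧x≢y⇒x∈p-y i∈p i≢x)

preimage : ∀ {n} → Perm n → ℕ → Subset n
preimage y t = tabulate (λ i → does (toℕ (y ⟨$⟩ʳ i) <? t))

∈-preimage⇔ : ∀ {n} (y : Perm n) t {i} → i ∈ preimage y t ⇔ toℕ (y ⟨$⟩ʳ i) < t
∈-preimage⇔ y t {i} = mk⇔
  (λ i∈ → witness (toℕ (y ⟨$⟩ʳ i) <? t) (trans (sym (lookup∘tabulate _ i)) ([]=⇒lookup i∈)))
  (λ yi<t → lookup⇒[]= i _ (trans (lookup∘tabulate _ i) (dec-true (toℕ (y ⟨$⟩ʳ i) <? t) yi<t)))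
  where
  witness : {P : Set} (P? : Dec P) → does P? ≡ true → P
  witness (yes p) _  = p
  witness (no _)  ()

module _ {n M : ℕ} (M<n : M < n) (y : Perm n) where
  private
    V : Subset n
    V = preimage y (suc M)

  preimage-cyc⁻¹ : ∀ x → toℕ x ≤ M → preimage (cyc⁻¹ (toℕ x) M · y) M ≡ V - (y ⟨$⟩ˡ x)
  preimage-cyc⁻¹ x x≤M = subset-ext λ i →
    ⇔.trans (∈-preimage⇔ (cyc⁻¹ (toℕ x) M · y) M)
    (⇔.trans (cyc⁻¹-<last⇔ M<n x≤M (y ⟨$⟩ʳ i))
    (⇔.trans (⇔.trans (mk⇔ s≤s ≤-pred) (⇔.sym (∈-preimage⇔ y (suc M))) ×-⇔ mk⇔ (_∘ hit) (_∘ unhit))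
    (⇔.sym ∈-remove⇔)))
    where
    hit : ∀ {i} → i ≡ y ⟨$⟩ˡ x → toℕ (y ⟨$⟩ʳ i) ≡ toℕ x
    hit refl = cong toℕ (inverseʳ y)
    unhit : ∀ {i} → toℕ (y ⟨$⟩ʳ i) ≡ toℕ x → i ≡ y ⟨$⟩ˡ x
    unhit yi≡x = trans (sym (inverseˡ y)) (cong (y ⟨$⟩ˡ_) (toℕ-injective yi≡x))

  ∑-cyc⁻¹-preimage : (F : Subset n → ℕ) → ∑ (upTo (suc M)) (λ a → F (preimage (cyc⁻¹ a M · y) M)) ≡ ∑Removals F V
  ∑-cyc⁻¹-preimage F = begin
    ∑ (upTo (suc M)) (λ a → F (preimage (cyc⁻¹ a M · y) M))
      ≡⟨ ∑-upTo≡∑ᶠ n (suc M) (λ a → F (preimage (cyc⁻¹ a M · y) M)) M<n ⟩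
    ∑ᶠ {n} (λ x → 𝟙 (toℕ x <? suc M) * F (preimage (cyc⁻¹ (toℕ x) M · y) M))
      ≡⟨ sum-cong-≗ {n} (λ x → 𝟙-*-cong (toℕ x <? suc M) (cong F ∘ preimage-cyc⁻¹ x ∘ ≤-pred)) ⟩
    ∑ᶠ {n} (λ x → 𝟙 (toℕ x <? suc M) * F (V - (y ⟨$⟩ˡ x)))
      ≡⟨ sum-permute (λ x → 𝟙 (toℕ x <? suc M) * F (V - (y ⟨$⟩ˡ x))) y ⟩
    ∑ᶠ {n} (λ x → 𝟙 (toℕ (y ⟨$⟩ʳ x) <? suc M) * F (V - (y ⟨$⟩ˡ (y ⟨$⟩ʳ x))))
      ≡⟨ sum-cong-≗ {n} (λ x → cong₂ _*_ (𝟙-⇔ (⇔.sym (∈-preimage⇔ y (suc M))) (toℕ (y ⟨$⟩ʳ x) <? suc M) (x ∈? V))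
                                        (cong (F ∘ (V -_)) (inverseˡ y))) ⟩
    ∑Removals F V
      ∎
    where open ≡-Reasoning

preimage-id : ∀ n → preimage {n} id n ≡ ⊤
preimage-id n = subset-ext λ i → mk⇔ (λ _ → ∈⊤) (λ _ → Equivalence.from (∈-preimage⇔ id n) (toℕ<n i))

∑-𝓑nk-preimage : ∀ n j → j ≤ n → (F : Subset n → ℕ) →
                 ∑ (𝓑nk n j) (λ y → F (preimage y (n ∸ j))) ≡ j ! * ∑Subsets n (n ∸ j) F
∑-𝓑nk-preimage n zero _ F rewrite range-empty n =
  trans (+-identityʳ _) (trans (cong F (preimage-id n)) (trans (sym (∑Subsets-⊤ n F)) (sym (+-identityʳ _))))
∑-𝓑nk-preimage n (suc j) j<n F = begin
  ∑ (𝓑nk n (suc j)) (λ y → F (preimage y M))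
    ≡⟨ ∑-𝓑nk-suc j<n (λ y → F (preimage y M)) ⟩
  ∑ (upTo (suc M)) (λ a → ∑ (𝓑nk n j) (λ y → F (preimage (cyc⁻¹ a M · y) M)))
    ≡⟨ ∑-swap (upTo (suc M)) (𝓑nk n j) _ ⟩
  ∑ (𝓑nk n j) (λ y → ∑ (upTo (suc M)) (λ a → F (preimage (cyc⁻¹ a M · y) M)))
    ≡⟨ ∑-cong (𝓑nk n j) (λ y → ∑-cyc⁻¹-preimage (m∸[1+n]<m j<n) y F) ⟩
  ∑ (𝓑nk n j) (λ y → ∑Removals F (preimage y (suc M)))
    ≡⟨ cong (λ t → ∑ (𝓑nk n j) (λ y → ∑Removals F (preimage y t))) (sym (m∸n≡1+m∸[1+n] j<n)) ⟩
  ∑ (𝓑nk n j) (λ y → ∑Removals F (preimage y (n ∸ j)))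
    ≡⟨ ∑-𝓑nk-preimage n j (<⇒≤ j<n) (∑Removals F) ⟩
  j ! * ∑Subsets n (n ∸ j) (∑Removals F)
    ≡⟨ cong (λ t → j ! * ∑Subsets n t (∑Removals F)) (m∸n≡1+m∸[1+n] j<n) ⟩
  j ! * ∑Subsets n (suc M) (∑Removals F)
    ≡⟨ cong (j ! *_) (∑Subsets-∑Removals n F M) ⟩
  j ! * ((n ∸ M) * ∑Subsets n M F)
    ≡⟨ cong (λ t → j ! * (t * ∑Subsets n M F)) (m∸[m∸n]≡n j<n) ⟩
  j ! * (suc j * ∑Subsets n M F)
    ≡⟨ sym (*-assoc (j !) (suc j) _) ⟩
  j ! * suc j * ∑Subsets n M F
    ≡⟨ cong (_* ∑Subsets n M F) (*-comm (j !) (suc j)) ⟩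
  suc j ! * ∑Subsets n M F
    ∎
  where
  open ≡-Reasoning
  M = n ∸ suc j

-- Every term y of 𝓑_{n,j} has y⁻¹ increasing below n − j, stated as a congruence for sums over 𝓑_{n,j}.
∑-𝓑nk-cong : ∀ n j → j ≤ n → {f g : Perm n → ℕ} → (∀ y → InverseIncreasingBelow (n ∸ j) y → f y ≡ g y) →
             ∑ (𝓑nk n j) f ≡ ∑ (𝓑nk n j) g
∑-𝓑nk-cong n zero _ f≗g rewrite range-empty n = cong (_+ 0) (f≗g id (λ _ _ _ p<q → p<q))
∑-𝓑nk-cong n (suc j) j<n {f} {g} f≗g = begin
  ∑ (𝓑nk n (suc j)) f
    ≡⟨ ∑-𝓑nk-suc j<n f ⟩
  ∑ (upTo (suc M)) (λ a → ∑ (𝓑nk n j) (λ y → f (cyc⁻¹ a M · y)))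
    ≡⟨ ∑-upTo-cong (suc M) (λ a a<M+1 → ∑-𝓑nk-cong n j (<⇒≤ j<n) (λ y inv-inc → f≗g _ (cyc⁻¹-· (≤-pred a<M+1) y inv-inc))) ⟩
  ∑ (upTo (suc M)) (λ a → ∑ (𝓑nk n j) (λ y → g (cyc⁻¹ a M · y)))
    ≡⟨ ∑-𝓑nk-suc j<n g ⟨
  ∑ (𝓑nk n (suc j)) g
    ∎
  where
  open ≡-Reasoning
  M = n ∸ suc j
  M<n = m∸[1+n]<m j<n
  cyc⁻¹-· : ∀ {a} → a ≤ M → ∀ y → InverseIncreasingBelow (n ∸ j) y → InverseIncreasingBelow M (cyc⁻¹ a M · y)
  cyc⁻¹-· a≤M y inv-inc x x' c⁻¹yx'<M c⁻¹yx<c⁻¹yx' = inv-inc x x'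
    (subst (toℕ (y ⟨$⟩ʳ x') <_) (sym (m∸n≡1+m∸[1+n] j<n))
      (s≤s (proj₁ (Equivalence.to (cyc⁻¹-<last⇔ M<n a≤M (y ⟨$⟩ʳ x')) c⁻¹yx'<M))))
    (cyc⁻¹-reflects-< M<n a≤M _ _ c⁻¹yx<c⁻¹yx' c⁻¹yx'<M)

increasingAlong⇔increasingOn-preimage : ∀ {n} t (w y : Perm n) → InverseIncreasingBelow t y →
                                        IncreasingAlong t y w ⇔ IncreasingOn w (preimage y t)
increasingAlong⇔increasingOn-preimage t w y inv-inc = mk⇔ to from
  where
  ŷ : Fin _ → ℕ
  ŷ i = toℕ (y ⟨$⟩ʳ i)
  to : IncreasingAlong t y w → IncreasingOn w (preimage y t)
  to along i j i∈ j∈ i<j with <-cmp (ŷ i) (ŷ j)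
  ... | tri< yi<yj _ _ = along i j (Equivalence.to (∈-preimage⇔ y t) j∈) yi<yj
  ... | tri≈ _ yi≡yj _ = ⊥-elim (<-irrefl (cong toℕ (⟨$⟩ʳ-injective y (toℕ-injective yi≡yj))) i<j)
  ... | tri> _ _ yj<yi = ⊥-elim (<-asym i<j (inv-inc j i (Equivalence.to (∈-preimage⇔ y t) i∈) yj<yi))
  from : IncreasingOn w (preimage y t) → IncreasingAlong t y w
  from inc p q yq<t yp<yq = inc p q (Equivalence.from (∈-preimage⇔ y t) (<-trans yp<yq yq<t))
                                    (Equivalence.from (∈-preimage⇔ y t) yq<t) (inv-inc p q yq<t yp<yq)

coeff-𝓑*nk⊗𝓑nk : ∀ n j → j ≤ n → (w : Perm n) →
                 coeff (𝓑*nk n j ⊗ 𝓑nk n j) w ≡ j ! * ∑Subsets n (n ∸ j) (𝟙 ∘ increasingOn? w)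
coeff-𝓑*nk⊗𝓑nk n j j≤n w = begin
  coeff (𝓑*nk n j ⊗ 𝓑nk n j) w
    ≡⟨ coeff≡∑ (𝓑*nk n j ⊗ 𝓑nk n j) w ⟩
  ∑ (𝓑*nk n j ⊗ 𝓑nk n j) (λ x → 𝟙 (x ≟ₚ w))
    ≡⟨ ∑-⊗ (𝓑*nk n j) (𝓑nk n j) _ ⟩
  ∑ (𝓑*nk n j) (λ x → ∑ (𝓑nk n j) (λ y → 𝟙 ((x · y) ≟ₚ w)))
    ≡⟨ ∑-swap (𝓑*nk n j) (𝓑nk n j) _ ⟩
  ∑ (𝓑nk n j) (λ y → ∑ (𝓑*nk n j) (λ x → 𝟙 ((x · y) ≟ₚ w)))
    ≡⟨ ∑-cong (𝓑nk n j) (λ y → trans (∑-cong (𝓑*nk n j) (λ x → 𝟙-≟ₚ-·-flip x y w)) (sym (coeff≡∑ (𝓑*nk n j) (w · flip y)))) ⟩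
  ∑ (𝓑nk n j) (λ y → coeff (𝓑*nk n j) (w · flip y))
    ≡⟨ ∑-cong (𝓑nk n j) (λ y → coeff-𝓑*nk n j j≤n (w · flip y)) ⟩
  ∑ (𝓑nk n j) (λ y → 𝟙 (increasingBelow? (n ∸ j) (w · flip y)))
    ≡⟨ ∑-𝓑nk-cong n j j≤n (λ y inv-inc → 𝟙-⇔
         (⇔.trans (increasingBelow-·⁻¹⇔ (n ∸ j) w y) (increasingAlong⇔increasingOn-preimage (n ∸ j) w y inv-inc))
         (increasingBelow? (n ∸ j) (w · flip y)) (increasingOn? w (preimage y (n ∸ j)))) ⟩
  ∑ (𝓑nk n j) (λ y → 𝟙 (increasingOn? w (preimage y (n ∸ j))))
    ≡⟨ ∑-𝓑nk-preimage n j j≤n (𝟙 ∘ increasingOn? w) ⟩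
  j ! * ∑Subsets n (n ∸ j) (𝟙 ∘ increasingOn? w)
    ∎
  where open ≡-Reasoning

noninv≡∑Subsets : ∀ {n} k (w : Perm n) → noninv k w ≡ ∑Subsets n k (𝟙 ∘ increasingOn? w)
noninv≡∑Subsets {n} k w = trans (length-filter≡∑𝟙 _ (allSubsets n))
  (∑-cong (allSubsets n) (λ U → 𝟙-×-dec (∣ U ∣ ≟ k) (increasingOn? w U)))

proposition2p11 : (n k : ℕ) → k ≤ n → (w : Perm n) →
    𝓡coeff n (n ∸ k) w ≡ noninv k w
proposition2p11 n k k≤n w = begin
  (coeff (𝓑*nk n j ⊗ 𝓑nk n j) w / j !) ⦃ j !≢0 ⦄
    ≡⟨ cong (λ c → (c / j !) ⦃ j !≢0 ⦄) (coeff-𝓑*nk⊗𝓑nk n j (m∸n≤m n k) w) ⟩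
  (j ! * ∑Subsets n (n ∸ j) G / j !) ⦃ j !≢0 ⦄
    ≡⟨ cong (λ c → (c / j !) ⦃ j !≢0 ⦄) (*-comm (j !) _) ⟩
  (∑Subsets n (n ∸ j) G * j ! / j !) ⦃ j !≢0 ⦄
    ≡⟨ m*n/n≡m (∑Subsets n (n ∸ j) G) (j !) ⦃ j !≢0 ⦄ ⟩
  ∑Subsets n (n ∸ j) G
    ≡⟨ cong (λ t → ∑Subsets n t G) (m∸[m∸n]≡n k≤n) ⟩
  ∑Subsets n k G
    ≡⟨ noninv≡∑Subsets k w ⟨
  noninv k w
    ∎
  where
  open ≡-Reasoning
  j = n ∸ k
  G = 𝟙 ∘ increasingOn? w
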